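{- Let $h_1\ge\dots\ge h_n>0$ be integers and $m\ge2$. If an $m\mathrm{RP}(h_1\dots h_n)$ exists, then a $k\mathrm{RP}(h_1\dots h_n)$ exists for every integer $k\ge m$ with $k\equiv1\pmod{m-1}$.
   Context: Let $N=\sum h_i$. An $m$-dimensional latin hypercube of order $N$ is a function $L:[N]^m\to[N]$ such that whenever two index tuples differ in exactly one coordinate their values differ. A subhypercube of order $h$ is the restriction of $L$ to $T_1\times\dots\times T_m$ with $|T_j|=h$ which is itself a latin hypercube of order $h$; subhypercubes are disjoint if their index sets are disjoint in every coordinate and their symbol sets are disjoint. An $m\mathrm{RP}(h_1\dots h_n)$ is an $m$-dimensional latin hypercube of order $N$ with pairwise disjoint subhypercubes of orders $h_1,\dots,h_n$. -}

module Defs where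

open import Data.Nat using (ℕ; zero; suc; _+_)
open import Data.Fin using (Fin)
open import Data.Product using (Σ; ∃; _×_; _,_)
open import Relation.Binary.PropositionalEquality using (_≡_; _≢_)
open import Function.Definitions using (Injective)

sumF : (n : ℕ) → (Fin n → ℕ) → ℕ
sumF zero    h = 0
sumF (suc n) h = h Fin.zero + sumF n (λ i → h (Fin.suc i))

Tuple : ℕ → ℕ → Set
Tuple m N = Fin m → Fin N

Hypercube : ℕ → ℕ → Set
Hypercube m N = Tuple m N → Fin N

DifferInExactlyOne : ∀ {m N} → Tuple m N → Tuple m N → Set
DifferInExactlyOne {m} x y =
  Σ (Fin m) λ j → (x j ≢ y j) × (∀ i → i ≢ j → x i ≡ y i)

IsLatin : ∀ {m N} → Hypercube m N → Set
IsLatin {m} {N} L = ∀ (x y : Tuple m N) → DifferInExactlyOne x y → L x ≢ L y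

-- A subhypercube of order h of L: for each coordinate j an h-element index
-- set T j (given as an injective enumeration Fin h → Fin N), an h-element
-- symbol set S (injective enumeration), such that the restriction of L to
-- T 1 × ... × T m takes values in S and, read through these enumerations,
-- is a latin hypercube of order h.
record Subhypercube {m N : ℕ} (L : Hypercube m N) (h : ℕ) : Set where
  field
    T        : Fin m → Fin h → Fin N
    T-inj    : ∀ j → Injective _≡_ _≡_ (T j)
    S        : Fin h → Fin N
    S-inj    : Injective _≡_ _≡_ S
    M        : Hypercube m h
    M-latin  : IsLatin M
    restrict : ∀ (x : Tuple m h) → L (λ j → T j (x j)) ≡ S (M x)

Disjoint : ∀ {m N} {L : Hypercube m N} {h h′ : ℕ} →
           Subhypercube L h → Subhypercube L h′ → Set
Disjoint {m} {h = h} {h′} A B =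
  (∀ (j : Fin m) (a : Fin h) (b : Fin h′) →
     Subhypercube.T A j a ≢ Subhypercube.T B j b) ×
  (∀ (a : Fin h) (b : Fin h′) → Subhypercube.S A a ≢ Subhypercube.S B b)

record RP (m n : ℕ) (h : Fin n → ℕ) : Set where
  field
    L        : Hypercube m (sumF n h)
    L-latin  : IsLatin L
    sub      : (i : Fin n) → Subhypercube L (h i)
    disjoint : ∀ (i i′ : Fin n) → i ≢ i′ → Disjoint (sub i) (sub i′)

-- Two operations on RPs suffice. Conjugation exchanges coordinate 0 with the
-- symbol, so the first index sets and the symbol sets of the subhypercubes
-- trade places. Composition substitutes an inner RP I of dimension 1 + r into
-- coordinate 0 of an outer RP O of dimension 1 + p, giving the hypercube
-- x ↦ O (I (x₀ … x_r), x_{r+1}, …) of dimension 1 + r + p; its subhypercubes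
-- are products of those of I and O, provided the symbol sets of I match the
-- first index sets of O. Composing with an m-dimensional RP R or with its
-- conjugate adds m − 1 to the dimension, and keeping one RP whose symbol sets
-- are those of R and one whose symbol sets are the first index sets of R
-- makes the matching condition hold at every step.
module Submission where

open import Defs
open import Data.Nat using (ℕ; zero; suc; _+_; _*_; _≤_; _≥_; _∸_)
open import Data.Fin using (Fin; toℕ)
open import Data.Product using (Σ; _×_)
open import Relation.Binary.PropositionalEquality using (_≡_)

open import Data.Fin using (zero; suc; _↑ˡ_; _↑ʳ_; splitAt; punchOut)
open import Data.Fin.Properties
  using (_≟_; any?; pigeonhole; punchOut-injective; suc-injective; ↑ˡ-injective; ↑ʳ-injective;
         splitAt-↑ˡ; splitAt-↑ʳ; splitAt⁻¹-↑ˡ; splitAt⁻¹-↑ʳ)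
import Data.Fin.Properties as Fin
import Data.Nat.Properties as ℕ
open import Data.Product using (∃; _,_; proj₁; proj₂)
open import Data.Sum using (inj₁; inj₂)
open import Data.Vec.Functional using (_∷_; tail; _++_; take; drop)
open import Data.Vec.Functional.Properties using (lookup-++ˡ; lookup-++ʳ)
open import Function using (_∘_)
open import Function.Definitions using (Injective)
open import Relation.Binary.PropositionalEquality
  using (refl; sym; trans; cong; cong-app; subst; _≢_; _≗_; module ≡-Reasoning)
open import Relation.Nullary using (¬_; yes; no; Dec; contradiction)

injective⇒surjective : ∀ {N} (f : Fin N → Fin N) → Injective _≡_ _≡_ f →
                       ∀ y → ∃ λ x → f x ≡ y
injective⇒surjective {suc N} f f-inj y with any? (λ x → f x ≟ y)
... | yes hit = hit
... | no miss = contradiction (λ x y≡fx → miss (x , sym y≡fx)) f-hits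
  where
  f-hits : ¬ (∀ x → y ≢ f x)
  f-hits y≢f
    with i , j , i<j , eq ← pigeonhole (ℕ.n<1+n N) (λ x → punchOut (y≢f x))
    = Fin.<-irrefl (f-inj (punchOut-injective (y≢f i) (y≢f j) eq)) i<j

↑ˡ≢↑ʳ : ∀ {m n} (a : Fin m) (b : Fin n) → a ↑ˡ n ≢ m ↑ʳ b
↑ˡ≢↑ʳ {m} {n} a b eq
  with () ← trans (sym (splitAt-↑ˡ m a n)) (trans (cong (splitAt m) eq) (splitAt-↑ʳ m n b))

module _ {p N : ℕ} {x y : Tuple (suc p) N} where

  differ-head : x zero ≢ y zero → tail x ≗ tail y → DifferInExactlyOne x y
  differ-head x₀≢y₀ agree = zero , x₀≢y₀ , λ
    { zero    0≢0 → contradiction refl 0≢0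
    ; (suc i) _   → agree i
    }

  differ-tail : x zero ≡ y zero → DifferInExactlyOne (tail x) (tail y) →
                DifferInExactlyOne x y
  differ-tail x₀≡y₀ (j , xj≢yj , others) = suc j , xj≢yj , λ
    { zero    _   → x₀≡y₀
    ; (suc i) i≢j → others i (i≢j ∘ cong suc)
    }

differ-∘ : ∀ {q m N} {x y : Tuple m N} (ρ : Fin q → Fin m) → Injective _≡_ _≡_ ρ →
           ∀ j → x (ρ j) ≢ y (ρ j) → (∀ i → i ≢ ρ j → x i ≡ y i) →
           DifferInExactlyOne (x ∘ ρ) (y ∘ ρ)
differ-∘ ρ ρ-inj j xj≢yj others = j , xj≢yj , λ i i≢j → others (ρ i) (i≢j ∘ ρ-inj)

module _ {p N : ℕ} {L : Hypercube (suc p) N} (L-latin : IsLatin L) where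

  line-injective : ∀ t → Injective _≡_ _≡_ (λ c → L (c ∷ t))
  line-injective t {c} {c′} eq with c ≟ c′
  ... | yes c≡c′ = c≡c′
  ... | no  c≢c′ = contradiction eq (L-latin _ _ (differ-head c≢c′ (λ _ → refl)))

  -- Tuples are functions, so this is not mere congruence: it is derived from
  -- the latin property through the line of x in direction 0, patched to take
  -- the value L x at x itself.
  latin-cong : ∀ {x y} → x ≗ y → L x ≡ L y
  latin-cong {x} {y} x≗y = conclude (proj₁ preimage ≟ x zero) (proj₂ preimage)
    where
    value : ∀ {c} → Dec (c ≡ x zero) → Fin N
    value     (yes _) = L x
    value {c} (no _)  = L (c ∷ tail x)

    off-x : ∀ {c} → c ≢ x zero → DifferInExactlyOne x (c ∷ tail x)
    off-x c≢x₀ = differ-head (c≢x₀ ∘ sym) (λ _ → refl)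

    value-injective : ∀ {c c′} (d : Dec (c ≡ x zero)) (d′ : Dec (c′ ≡ x zero)) →
                      value d ≡ value d′ → c ≡ c′
    value-injective (yes c≡x₀)  (yes c′≡x₀) _  = trans c≡x₀ (sym c′≡x₀)
    value-injective (yes _)     (no c′≢x₀)  eq = contradiction eq (L-latin _ _ (off-x c′≢x₀))
    value-injective (no c≢x₀)   (yes _)     eq = contradiction (sym eq) (L-latin _ _ (off-x c≢x₀))
    value-injective (no _)      (no _)      eq = line-injective (tail x) eq

    preimage : ∃ λ c → value (c ≟ x zero) ≡ L y
    preimage = injective⇒surjective (λ c → value (c ≟ x zero))
                 (λ {c} {c′} → value-injective (c ≟ x zero) (c′ ≟ x zero)) (L y)

    conclude : ∀ {c} (d : Dec (c ≡ x zero)) → value d ≡ L y → L x ≡ L y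
    conclude     (yes _)    eq = eq
    conclude {c} (no c≢x₀) eq = contradiction eq (L-latin _ _ (differ-head c≢y₀ (x≗y ∘ suc)))
      where
      c≢y₀ : c ≢ y zero
      c≢y₀ c≡y₀ = c≢x₀ (trans c≡y₀ (sym (x≗y zero)))

symbols : ∀ {m n h} → RP m n h → (i : Fin n) → Fin (h i) → Fin (sumF n h)
symbols R i = Subhypercube.S (RP.sub R i)

leadingIndices : ∀ {p n h} → RP (suc p) n h → (i : Fin n) → Fin (h i) → Fin (sumF n h)
leadingIndices R i = Subhypercube.T (RP.sub R i) zero

module Conjugate {p N : ℕ} (L : Hypercube (suc p) N) (L-latin : IsLatin L) where

  private
    solve : ∀ w → ∃ λ c → L (c ∷ tail w) ≡ w zero
    solve w = injective⇒surjective _ (line-injective L-latin (tail w)) (w zero)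

  conjugate : Hypercube (suc p) N
  conjugate w = proj₁ (solve w)

  conjugate-spec : ∀ w → L (conjugate w ∷ tail w) ≡ w zero
  conjugate-spec w = proj₂ (solve w)

  conjugate-unique : ∀ w {c} → L (c ∷ tail w) ≡ w zero → conjugate w ≡ c
  conjugate-unique w eq = line-injective L-latin (tail w) (trans (conjugate-spec w) (sym eq))

  conjugate-latin : IsLatin conjugate
  conjugate-latin x y (zero , x₀≢y₀ , others) eq = x₀≢y₀ (begin
    x zero                      ≡⟨ conjugate-spec x ⟨
    L (conjugate x ∷ tail x)    ≡⟨ cong (λ c → L (c ∷ tail x)) eq ⟩
    L (conjugate y ∷ tail x)    ≡⟨ latin-cong L-latin agree ⟩
    L (conjugate y ∷ tail y)    ≡⟨ conjugate-spec y ⟩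
    y zero                      ∎)
    where
    open ≡-Reasoning
    agree : conjugate y ∷ tail x ≗ conjugate y ∷ tail y
    agree zero    = refl
    agree (suc i) = others (suc i) (λ ())
  conjugate-latin x y (suc j , xj≢yj , others) eq =
    L-latin (conjugate x ∷ tail x) (conjugate x ∷ tail y)
      (differ-tail refl (differ-∘ suc suc-injective j xj≢yj others))
      (begin
        L (conjugate x ∷ tail x)  ≡⟨ conjugate-spec x ⟩
        x zero                    ≡⟨ others zero (λ ()) ⟩
        y zero                    ≡⟨ conjugate-spec y ⟨
        L (conjugate y ∷ tail y)  ≡⟨ cong (λ c → L (c ∷ tail y)) eq ⟨
        L (conjugate x ∷ tail y)  ∎)
    where open ≡-Reasoning

module _ {p N : ℕ} {L : Hypercube (suc p) N} (L-latin : IsLatin L) where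
  open Conjugate L L-latin

  conjugate-sub : ∀ {h} → Subhypercube L h → Subhypercube conjugate h
  conjugate-sub {h} A = record
    { T        = S ∷ tail T
    ; T-inj    = λ { zero → S-inj ; (suc j) → T-inj (suc j) }
    ; S        = T zero
    ; S-inj    = T-inj zero
    ; M        = M′
    ; M-latin  = M′-latin
    ; restrict = λ x → conjugate-unique (λ j → (S ∷ tail T) j (x j)) (restricted x)
    }
    where
    open Subhypercube A
    open Conjugate M M-latin using ()
      renaming (conjugate to M′; conjugate-spec to M′-spec; conjugate-latin to M′-latin)
    open ≡-Reasoning

    restricted : ∀ x → L (T zero (M′ x) ∷ (λ i → T (suc i) (x (suc i)))) ≡ S (x zero)
    restricted x = begin
      L (T zero (M′ x) ∷ (λ i → T (suc i) (x (suc i))))  ≡⟨ latin-cong L-latin (λ { zero → refl ; (suc i) → refl }) ⟩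
      L (λ j → T j ((M′ x ∷ tail x) j))                  ≡⟨ restrict (M′ x ∷ tail x) ⟩
      S (M (M′ x ∷ tail x))                              ≡⟨ cong S (M′-spec x) ⟩
      S (x zero)                                         ∎

conjugate-RP : ∀ {p n h} → RP (suc p) n h → RP (suc p) n h
conjugate-RP R = record
  { L        = conjugate
  ; L-latin  = conjugate-latin
  ; sub      = λ i → conjugate-sub L-latin (sub i)
  ; disjoint = λ i i′ i≢i′ → swap {A = sub i} {B = sub i′} (disjoint i i′ i≢i′)
  }
  where
  open RP R
  open Conjugate L L-latin

  swap : ∀ {h h′} {A : Subhypercube L h} {B : Subhypercube L h′} →
         Disjoint A B → Disjoint (conjugate-sub L-latin A) (conjugate-sub L-latin B)
  swap (T-disjoint , S-disjoint) =
    (λ { zero → S-disjoint ; (suc j) → T-disjoint (suc j) }) , T-disjoint zero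

compose : ∀ {r p N} → Hypercube (suc r) N → Hypercube (suc p) N → Hypercube (suc r + p) N
compose {r} I O x = O (I (take (suc r) x) ∷ drop (suc r) x)

module _ {r p N : ℕ} {I : Hypercube (suc r) N} {O : Hypercube (suc p) N}
         (I-latin : IsLatin I) (O-latin : IsLatin O) where

  compose-latin : IsLatin (compose I O)
  compose-latin x y (j , xj≢yj , others) eq with splitAt (suc r) j in split
  ... | inj₁ a with refl ← splitAt⁻¹-↑ˡ {i = j} split =
    O-latin _ _ (differ-head (I-latin _ _ inner-differ) (λ b → others _ (↑ˡ≢↑ʳ a b ∘ sym))) eq
    where
    inner-differ : DifferInExactlyOne (take (suc r) x) (take (suc r) y)
    inner-differ = differ-∘ (_↑ˡ p) (↑ˡ-injective p _ _) a xj≢yj others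
  ... | inj₂ b with refl ← splitAt⁻¹-↑ʳ {i = j} split =
    O-latin _ _ (differ-tail inner-equal outer-differ) eq
    where
    inner-equal : I (take (suc r) x) ≡ I (take (suc r) y)
    inner-equal = latin-cong I-latin (λ a → others _ (↑ˡ≢↑ʳ a b))
    outer-differ : DifferInExactlyOne (drop (suc r) x) (drop (suc r) y)
    outer-differ = differ-∘ (suc r ↑ʳ_) (↑ʳ-injective (suc r) _ _) b xj≢yj others

module _ {r p N : ℕ} {I : Hypercube (suc r) N} {O : Hypercube (suc p) N}
         (I-latin : IsLatin I) (O-latin : IsLatin O) where

  compose-sub : ∀ {h} (A : Subhypercube I h) (B : Subhypercube O h) →
                Subhypercube.S A ≗ Subhypercube.T B zero → Subhypercube (compose I O) h
  compose-sub {h} A B S≗T₀ = record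
    { T        = T
    ; T-inj    = T-inj
    ; S        = B.S
    ; S-inj    = B.S-inj
    ; M        = compose A.M B.M
    ; M-latin  = compose-latin A.M-latin B.M-latin
    ; restrict = restrict
    }
    where
    module A = Subhypercube A
    module B = Subhypercube B
    open ≡-Reasoning

    T : Fin (suc r + p) → Fin h → Fin N
    T = A.T ++ tail B.T

    T-inj : ∀ j → Injective _≡_ _≡_ (T j)
    T-inj j with splitAt (suc r) j
    ... | inj₁ a = A.T-inj a
    ... | inj₂ b = B.T-inj (suc b)

    restrict : ∀ x → compose I O (λ j → T j (x j)) ≡ B.S (compose A.M B.M x)
    restrict x = begin
      compose I O (λ j → T j (x j))                    ≡⟨ latin-cong O-latin entries ⟩
      O (λ j → B.T j ((inner ∷ drop (suc r) x) j))     ≡⟨ B.restrict (inner ∷ drop (suc r) x) ⟩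
      B.S (compose A.M B.M x)                          ∎
      where
      inner : Fin h
      inner = A.M (take (suc r) x)
      entries : I (take (suc r) (λ j → T j (x j))) ∷ drop (suc r) (λ j → T j (x j)) ≗
                (λ j → B.T j ((inner ∷ drop (suc r) x) j))
      entries zero = begin
        I (λ a → T (a ↑ˡ p) (x (a ↑ˡ p)))  ≡⟨ latin-cong I-latin (λ a → cong-app (lookup-++ˡ A.T _ a) _) ⟩
        I (λ a → A.T a (x (a ↑ˡ p)))       ≡⟨ A.restrict (take (suc r) x) ⟩
        A.S inner                           ≡⟨ S≗T₀ inner ⟩
        B.T zero inner                      ∎
      entries (suc b) = cong-app (lookup-++ʳ A.T (tail B.T) b) _

compose-RP : ∀ {r p n h} (I : RP (suc r) n h) (O : RP (suc p) n h) →
             (∀ i → symbols I i ≗ leadingIndices O i) → RP (suc r + p) n h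
compose-RP {r} {h = h} I O link = record
  { L        = compose I.L O.L
  ; L-latin  = compose-latin I.L-latin O.L-latin
  ; sub      = sub
  ; disjoint = λ i i′ i≢i′ → T-disjoint i i′ i≢i′ , proj₂ (O.disjoint i i′ i≢i′)
  }
  where
  module I = RP I
  module O = RP O

  sub : ∀ i → Subhypercube (compose I.L O.L) (h i)
  sub i = compose-sub I.L-latin O.L-latin (I.sub i) (O.sub i) (link i)

  T-disjoint : ∀ i i′ → i ≢ i′ → ∀ j a b → Subhypercube.T (sub i) j a ≢ Subhypercube.T (sub i′) j b
  T-disjoint i i′ i≢i′ j a b with splitAt (suc r) j
  ... | inj₁ j′ = proj₁ (I.disjoint i i′ i≢i′) j′ a b
  ... | inj₂ j′ = proj₁ (O.disjoint i i′ i≢i′) (suc j′) a b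

module Powers {p n h} (R : RP (suc p) n h) where

  WithSymbols : ℕ → ((i : Fin n) → Fin (h i) → Fin (sumF n h)) → Set
  WithSymbols d σ = Σ (RP (suc d) n h) λ A → ∀ i → symbols A i ≗ σ i

  Reachable : ℕ → Set
  Reachable d = WithSymbols d (symbols R) × WithSymbols d (leadingIndices R)

  reachable-step : ∀ {d} → Reachable d → Reachable (d + p)
  reachable-step ((A , A-symbols) , (B , B-symbols)) =
    (compose-RP B R B-symbols , λ _ _ → refl) ,
    (compose-RP A (conjugate-RP R) A-symbols , λ _ _ → refl)

  reachable : ∀ q → Reachable (suc q * p)
  reachable zero    = subst Reachable (sym (ℕ.+-identityʳ p))
                        ((R , λ _ _ → refl) , (conjugate-RP R , λ _ _ → refl))
  reachable (suc q) = subst Reachable (ℕ.+-comm (suc q * p) p) (reachable-step (reachable q))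

corollary22 : (n : ℕ) (h : Fin n → ℕ) (m : ℕ) →
    (∀ (i j : Fin n) → toℕ i ≤ toℕ j → h j ≤ h i) →
    (∀ (i : Fin n) → 1 ≤ h i) →
    m ≥ 2 →
    RP m n h →
    ∀ (k : ℕ) → k ≥ m → (Σ ℕ λ q → k ≡ 1 + q * (m ∸ 1)) →
    RP k n h
corollary22 n h (suc p) _ _ m≥2 R k k≥m (zero , refl) =
  contradiction (ℕ.≤-trans m≥2 k≥m) (ℕ.<-irrefl refl)
corollary22 n h (suc p) _ _ m≥2 R k k≥m (suc q , refl) =
  proj₁ (proj₁ (Powers.reachable R q))
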